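{- Let $\lambda\ge1$ be a fixed time window size. Let $L^n$ be the path on nodes $\{0,\dots,n-1\}$ with edges $(i,i+1)$, thresholds $t(i)\in\{1,2\}$ for all $i$, and $t(0)=t(n-1)=2$. For $0\le i\le n-1$ let $L_i^n$ be the subpath on nodes $\{i,\dots,n-1\}$ (same thresholds), and let $s(i)$ be the minimum size of a TWC target set for $L_i^n$ (time window size $\lambda$) that contains both $i$ and $n-1$. Define $D[n-1]=n-1$ and $D[i]=\min\{j: i<j\le n-1,\ t(j)=2\}$ for $0\le i<n-1$. Then for each node $k\in\{0,\dots,n-1\}$ with $t(k)=2$ there exists an integer $s_k$ such that $s(i)\in\{s_k,\,s_k-1\}$ for every $i=k,k+1,\dots,D[k]$.
   Context: For a graph $H=(V,E)$ with thresholds $t:V\to\{1,2,\dots\}$, a time window size $\lambda$ and $S\subseteq V$, define $\mathrm{Inf}[S,0]=S$, $\mathrm{Act}[S,0]=\emptyset$, and for $r\ge1$: $\mathrm{Act}[S,r]=\mathrm{Inf}[S,r-1]$ if $r\le\lambda$, $\mathrm{Act}[S,r]=\mathrm{Inf}[S,r-1]\setminus\mathrm{Inf}[S,r-1-\lambda]$ if $r>\lambda$, and $\mathrm{Inf}[S,r]=\mathrm{Inf}[S,r-1]\cup\{v: |N_H(v)\cap \mathrm{Act}[S,r]|\ge t(v)\}$, where $N_H(v)$ is the neighborhood of $v$ in $H$. $S$ is a TWC target set for $H$ if $\mathrm{Inf}[S,r]=V$ for some $r\ge0$. -}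

module Defs where

open import Data.Nat using (ℕ; zero; suc; _+_; _∸_; _≤_; _≤ᵇ_; _<ᵇ_; _≡ᵇ_)
open import Data.Bool using (Bool; true; false; _∧_; _∨_; not; if_then_else_)
open import Data.List using (List; drop)
import Data.List as L
open import Data.List.NonEmpty using (List⁺; [_]; _∷⁺_; head; toList)
open import Data.Maybe using (Maybe; just; nothing)
open import Data.Product using (Σ; _×_)
open import Relation.Binary.PropositionalEquality using (_≡_)

VSet : Set
VSet = ℕ → Bool

∅ : VSet
∅ _ = false

inV : ℕ → ℕ → ℕ → Bool
inV n i v = (i ≤ᵇ v) ∧ (v <ᵇ n)

-- |N(v) ∩ A| in L_i^n (edges (j, j+1) with both ends in {i..n-1}).
nbrCount : ℕ → ℕ → VSet → ℕ → ℕ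
nbrCount n i A v = low v + (if inV n i (suc v) ∧ A (suc v) then 1 else 0)
  where
  low : ℕ → ℕ
  low zero = 0
  low (suc u) = if inV n i u ∧ A u then 1 else 0

-- History [Inf[S,r], Inf[S,r-1], ..., Inf[S,0]] of the TWC process on L_i^n
-- with thresholds t and time window size w.
module Process (t : ℕ → ℕ) (n i w : ℕ) (S : VSet) where

  -- Act[S,r+1] from the history up to round r:
  -- Inf[S,r] if r+1 ≤ w, and Inf[S,r] \ Inf[S,r-w] if r+1 > w
  actFrom : List⁺ VSet → VSet
  actFrom h v with L.head (drop w (toList h))
  ... | nothing  = head h v
  ... | just old = head h v ∧ not (old v)

  hist : ℕ → List⁺ VSet
  hist zero = [ S ]
  hist (suc r) =
    (λ v → head (hist r) v ∨ (inV n i v ∧ (t v ≤ᵇ nbrCount n i (actFrom (hist r)) v)))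
      ∷⁺ hist r

  Inf : ℕ → VSet
  Inf r = head (hist r)

  Act : ℕ → VSet
  Act zero = ∅
  Act (suc r) = actFrom (hist r)

IsTWCTarget : (ℕ → ℕ) → ℕ → ℕ → ℕ → VSet → Set
IsTWCTarget t n i w S = Σ ℕ (λ r → ∀ v → Process.Inf t n i w S r v ≡ inV n i v)

SubsetV : ℕ → ℕ → VSet → Set
SubsetV n i S = ∀ v → S v ≡ true → inV n i v ≡ true

size : ℕ → VSet → ℕ
size zero S = 0
size (suc m) S = size m S + (if S m then 1 else 0)

Admissible : (ℕ → ℕ) → ℕ → ℕ → ℕ → VSet → Set
Admissible t n i w S =
  SubsetV n i S × S i ≡ true × S (n ∸ 1) ≡ true × IsTWCTarget t n i w S

IsMinSize : (ℕ → ℕ) → ℕ → ℕ → ℕ → ℕ → Set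
IsMinSize t n i w m =
  Σ VSet (λ S → Admissible t n i w S × size n S ≡ m)
  × (∀ S → Admissible t n i w S → m ≤ size n S)

nextTwo : (ℕ → ℕ) → ℕ → ℕ → ℕ
nextTwo t j zero = j
nextTwo t j (suc f) = if t j ≡ᵇ 2 then j else nextTwo t (suc j) f

D : (ℕ → ℕ) → ℕ → ℕ → ℕ
D t n k = if k ≡ᵇ (n ∸ 1) then n ∸ 1 else nextTwo t (suc k) (n ∸ 1 ∸ suc k)

-- Let d = D[k]: then t(d) = 2 and every node strictly between k and d has
-- threshold 1.  For every i ∈ [k, d] we show s(d) ≤ s(i) ≤ s(d) + 1, so that
-- s_k = s(d) + 1 works.
--   * s(i) ≤ s(d) + 1 (extend): adding i to a target set of L_d^n gives one of
--     L_i^n, because infection travels from i through the threshold-1 nodes up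
--     to d (Spread), and from d on both processes coincide (Locality).
--   * s(d) ≤ s(i) (restrict): let S be a target set of L_i^n and e its first
--     seed ≥ d.  As t(d) = 2, infection enters [d, e) only from the right, so
--     the nodes of (d, e) have threshold 1 (Barrier).  Hence {d} ∪ (S ∩ (d, ∞))
--     is a target set of L_d^n (splice), and it trades i for d.
-- That the minimum s(d) exists needs that being a target set is decidable
-- (Decide: the process is stationary by round (n + 1)·w) and an exhaustive
-- search for a minimum-size admissible set (MinimumSearch).
module Submission where

open import Defs
open import Data.Nat using (ℕ; zero; suc; _+_; _*_; _∸_; _≤_; _<_; _≤′_; ≤′-refl; ≤′-step; _≤ᵇ_; _<ᵇ_; _≡ᵇ_; z≤n; s≤s; _≤?_; _<?_; _≟_)
open import Data.Nat.Properties
open import Data.Nat.Induction using (<-rec)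
open import Data.Bool using (Bool; true; false; _∧_; _∨_; not; if_then_else_)
open import Data.Bool.Properties using (T-≡; ∨-zeroʳ; ∧-zeroʳ; ∧-inverseʳ) renaming (_≟_ to _≟ᵇ_)
open import Data.List using (drop)
import Data.List as L
open import Data.List.NonEmpty using (toList)
open import Data.Maybe using (just; nothing)
open import Data.Sum using (_⊎_; inj₁; inj₂) renaming ([_,_] to either)
open import Data.Product using (∃; Σ; _×_; _,_; proj₁; proj₂)
open import Data.Empty using (⊥-elim)
open import Function.Bundles using (Equivalence)
open import Relation.Binary.PropositionalEquality
open import Relation.Nullary using (¬_; Dec; yes; no)

true-or-false : ∀ b → b ≡ true ⊎ b ≡ false
true-or-false true = inj₁ refl
true-or-false false = inj₂ refl

true≢false : ¬ (true ≡ false)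
true≢false ()

∧-elim : ∀ {a b} → (a ∧ b) ≡ true → a ≡ true × b ≡ true
∧-elim {true} {true} _ = refl , refl

∧-intro : ∀ {a b} → a ≡ true → b ≡ true → (a ∧ b) ≡ true
∧-intro refl refl = refl

≤ᵇ-sound : ∀ {m k} → (m ≤ᵇ k) ≡ true → m ≤ k
≤ᵇ-sound {m} {k} e = ≤ᵇ⇒≤ m k (Equivalence.from T-≡ e)

≤ᵇ-complete : ∀ {m k} → m ≤ k → (m ≤ᵇ k) ≡ true
≤ᵇ-complete p = Equivalence.to T-≡ (≤⇒≤ᵇ p)

<ᵇ-sound : ∀ {m k} → (m <ᵇ k) ≡ true → m < k
<ᵇ-sound {m} {k} e = <ᵇ⇒< m k (Equivalence.from T-≡ e)

<ᵇ-complete : ∀ {m k} → m < k → (m <ᵇ k) ≡ true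
<ᵇ-complete p = Equivalence.to T-≡ (<⇒<ᵇ p)

≡ᵇ-sound : ∀ {m k} → (m ≡ᵇ k) ≡ true → m ≡ k
≡ᵇ-sound {m} {k} e = ≡ᵇ⇒≡ m k (Equivalence.from T-≡ e)

≡ᵇ-complete : ∀ {m k} → m ≡ k → (m ≡ᵇ k) ≡ true
≡ᵇ-complete {m} {k} p = Equivalence.to T-≡ (≡⇒≡ᵇ m k p)

≡ᵇ-refuse : ∀ {m k} → m ≢ k → (m ≡ᵇ k) ≡ false
≡ᵇ-refuse {m} {k} ne with true-or-false (m ≡ᵇ k)
... | inj₁ e = ⊥-elim (ne (≡ᵇ-sound e))
... | inj₂ e = e

≤-last : ∀ {v n} → v < n → v ≤ n ∸ 1
≤-last {v} {suc n} (s≤s p) = p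

last<n : ∀ {v n} → v < n → n ∸ 1 < n
last<n {v} {suc n} _ = ≤-refl

-- (the first argument only witnesses that n is positive)
≤-last⇒< : ∀ {u v n} → u < n → v ≤ n ∸ 1 → v < n
≤-last⇒< {n = suc n} _ p = s≤s p

inV-elim : ∀ {n i v} → inV n i v ≡ true → i ≤ v × v < n
inV-elim e with ∧-elim e
... | p , q = ≤ᵇ-sound p , <ᵇ-sound q

inV-intro : ∀ {n i v} → i ≤ v → v < n → inV n i v ≡ true
inV-intro p q rewrite ≤ᵇ-complete p | <ᵇ-complete q = refl

inV-agree : ∀ n {i₁ i₂ x} → i₁ ≤ x → i₂ ≤ x → inV n i₁ x ≡ inV n i₂ x
inV-agree n p q rewrite ≤ᵇ-complete p | ≤ᵇ-complete q = refl

inV-beyond : ∀ {n i v} → n ≤ v → inV n i v ≡ false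
inV-beyond {n} {i} {v} nv with true-or-false (inV n i v)
... | inj₂ e = e
... | inj₁ e = ⊥-elim (<⇒≱ (proj₂ (inV-elim {n} {i} e)) nv)

insert : ℕ → VSet → VSet
insert p A v = (v ≡ᵇ p) ∨ A v

insert-here : ∀ p A → insert p A p ≡ true
insert-here p A rewrite ≡ᵇ-complete {p} refl = refl

insert-there : ∀ p A {v} → A v ≡ true → insert p A v ≡ true
insert-there p A {v} e = trans (cong ((v ≡ᵇ p) ∨_) e) (∨-zeroʳ _)

insert-other : ∀ p A {v} → v ≢ p → insert p A v ≡ A v
insert-other p A ne rewrite ≡ᵇ-refuse ne = refl

insert-elim : ∀ p A {v} → insert p A v ≡ true → v ≡ p ⊎ A v ≡ true
insert-elim p A {v} e with v ≟ p
... | yes v≡p = inj₁ v≡p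
... | no v≢p = inj₂ (trans (sym (insert-other p A v≢p)) e)

above : ℕ → VSet → VSet
above d A v = (d <ᵇ v) ∧ A v

above-agree : ∀ d A {v} → d < v → above d A v ≡ A v
above-agree d A dv rewrite <ᵇ-complete dv = refl

above-elim : ∀ d A {v} → above d A v ≡ true → d < v × A v ≡ true
above-elim d A e with ∧-elim e
... | dv , av = <ᵇ-sound dv , av

above-below : ∀ d A {v} → v ≤ d → above d A v ≡ false
above-below d A {v} vd with true-or-false (d <ᵇ v)
... | inj₁ e = ⊥-elim (<⇒≱ (<ᵇ-sound e) vd)
... | inj₂ e rewrite e = refl

_⊆⟨_⟩_ : VSet → ℕ → VSet → Set
A ⊆⟨ m ⟩ B = ∀ u → u < m → A u ≡ true → B u ≡ true

⊆-pred : ∀ {A B m} → A ⊆⟨ suc m ⟩ B → A ⊆⟨ m ⟩ B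
⊆-pred sub u um = sub u (m≤n⇒m≤1+n um)

ind : Bool → ℕ
ind b = if b then 1 else 0

ind≤1 : ∀ b → ind b ≤ 1
ind≤1 true = ≤-refl
ind≤1 false = z≤n

ind-mono : ∀ {b c} → (b ≡ true → c ≡ true) → ind b ≤ ind c
ind-mono {false} _ = z≤n
ind-mono {true} f rewrite f refl = ≤-refl

size-bound : ∀ m A → size m A ≤ m
size-bound zero A = z≤n
size-bound (suc m) A = ≤-trans (+-mono-≤ (size-bound m A) (ind≤1 (A m))) (≤-reflexive (+-comm m 1))

size-mono : ∀ m A B → A ⊆⟨ m ⟩ B → size m A ≤ size m B
size-mono zero A B sub = z≤n
size-mono (suc m) A B sub = +-mono-≤ (size-mono m A B (⊆-pred sub)) (ind-mono (sub m ≤-refl))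

size-strict : ∀ m A B p → A ⊆⟨ m ⟩ B → p < m → A p ≡ false → B p ≡ true → size m A < size m B
size-strict (suc m) A B p sub pm ap bp with m≤n⇒m<n∨m≡n (≤-pred pm)
... | inj₁ p<m = +-mono-<-≤ (size-strict m A B p (⊆-pred sub) p<m ap bp) (ind-mono (sub m ≤-refl))
... | inj₂ refl rewrite ap | bp = +-mono-≤-< (size-mono p A B (⊆-pred sub)) ≤-refl

size-≡⇒≡ : ∀ m A B → A ⊆⟨ m ⟩ B → size m A ≡ size m B → ∀ u → u < m → A u ≡ B u
size-≡⇒≡ m A B sub eq u um with true-or-false (A u) | true-or-false (B u)
... | inj₁ a | _ = trans a (sym (sub u um a))
... | inj₂ a | inj₂ b = trans a (sym b)
... | inj₂ a | inj₁ b = ⊥-elim (<-irrefl eq (size-strict m A B u sub um a b))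

size-insert : ∀ m p A B → B ⊆⟨ m ⟩ insert p A → size m B ≤ suc (size m A)
size-insert zero p A B sub = z≤n
size-insert (suc m) p A B sub with m ≟ p
... | no m≢p = +-mono-≤ (size-insert m p A B (⊆-pred sub)) (ind-mono (λ bm → from-insert (sub m ≤-refl bm)))
  where
  from-insert : insert p A m ≡ true → A m ≡ true
  from-insert e = trans (sym (insert-other p A m≢p)) e
... | yes refl = begin
    size m B + ind (B m)  ≤⟨ +-mono-≤ (size-mono m B A below-p) (ind≤1 (B m)) ⟩
    size m A + 1          ≡⟨ +-comm (size m A) 1 ⟩
    suc (size m A)        ≤⟨ s≤s (m≤m+n (size m A) _) ⟩
    suc (size m A + ind (A m)) ∎
  where
  open ≤-Reasoning
  below-p : B ⊆⟨ m ⟩ A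
  below-p u um bu = trans (sym (insert-other m A (<⇒≢ um))) (sub u (m≤n⇒m≤1+n um) bu)

Thresholds : (ℕ → ℕ) → ℕ → Set
Thresholds t n = ∀ v → v < n → t v ≡ 1 ⊎ t v ≡ 2

threshold-pos : ∀ {t n} → Thresholds t n → ∀ v → v < n → 1 ≤ t v
threshold-pos ts v vn with ts v vn
... | inj₁ e = ≤-reflexive (sym e)
... | inj₂ e = subst (1 ≤_) (sym e) (s≤s z≤n)

module Run (t : ℕ → ℕ) (n w i : ℕ) (S : VSet) where
  open Process t n i w S public

  history-at : ∀ j r → j ≤ r → L.head (drop j (toList (hist r))) ≡ just (Inf (r ∸ j))
  history-at zero r _ = refl
  history-at (suc j) (suc r) (s≤s p) = history-at j r p

  history-short : ∀ j r → r < j → L.head (drop j (toList (hist r))) ≡ nothing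
  history-short (suc zero) zero _ = refl
  history-short (suc (suc j)) zero _ = refl
  history-short (suc j) (suc r) (s≤s p) = history-short j r p

  act-late : ∀ r v → w ≤ r → Act (suc r) v ≡ (Inf r v ∧ not (Inf (r ∸ w) v))
  act-late r v p rewrite history-at w r p = refl

  act-early : ∀ r v → r < w → Act (suc r) v ≡ Inf r v
  act-early r v p rewrite history-short w r p = refl

  inf-step : ∀ {r v} → Inf r v ≡ true → Inf (suc r) v ≡ true
  inf-step e rewrite e = refl

  inf-mono : ∀ {r r' v} → r ≤ r' → Inf r v ≡ true → Inf r' v ≡ true
  inf-mono {r} {v = v} le e = go (≤⇒≤′ le)
    where
    go : ∀ {r'} → r ≤′ r' → Inf r' v ≡ true
    go ≤′-refl = e
    go (≤′-step p) = inf-step (go p)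

  not-yet : ∀ {r r' v} → r ≤ r' → Inf r' v ≡ false → Inf r v ≡ false
  not-yet {r} {r'} {v} le e with true-or-false (Inf r v)
  ... | inj₂ f = f
  ... | inj₁ t' = ⊥-elim (true≢false (trans (sym (inf-mono le t')) e))

  act⇒inf : ∀ r v → Act (suc r) v ≡ true → Inf r v ≡ true
  act⇒inf r v e with w ≤? r
  ... | yes p = proj₁ (∧-elim (trans (sym (act-late r v p)) e))
  ... | no p = trans (sym (act-early r v (≰⇒> p))) e

  seed-active : 1 ≤ w → ∀ v → S v ≡ true → Act 1 v ≡ true
  seed-active w1 v e = trans (act-early 0 v w1) e

  fresh-active : 1 ≤ w → ∀ r v → Inf (suc r) v ≡ true → Inf r v ≡ false → Act (suc (suc r)) v ≡ true
  fresh-active w1 r v e f with w ≤? suc r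
  ... | no p = trans (act-early (suc r) v (≰⇒> p)) e
  ... | yes p rewrite act-late (suc r) v p | e | not-yet {suc r ∸ w} {r} {v} (∸-monoʳ-≤ (suc r) w1) f = refl

  inf⊆V : SubsetV n i S → ∀ r v → Inf r v ≡ true → inV n i v ≡ true
  inf⊆V sub zero v e = sub v e
  inf⊆V sub (suc r) v e with true-or-false (Inf r v)
  ... | inj₁ old = inf⊆V sub r v old
  ... | inj₂ old rewrite old = proj₁ (∧-elim e)

  infect : ∀ r v → inV n i v ≡ true → t v ≤ nbrCount n i (Act (suc r)) v → Inf (suc r) v ≡ true
  infect r v e p rewrite e | ≤ᵇ-complete p with Inf r v
  ... | true = refl
  ... | false = refl

  newly-infected : ∀ r v → Inf (suc r) v ≡ true → Inf r v ≡ false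
                 → inV n i v ≡ true × t v ≤ nbrCount n i (Act (suc r)) v
  newly-infected r v e f rewrite f with ∧-elim e
  ... | p , q = p , ≤ᵇ-sound q

LeftOff : VSet → ℕ → Set
LeftOff A v = ∀ u → suc u ≡ v → A u ≡ false

count-left : ∀ n i A x → (inV n i x ∧ A x) ≡ true → 1 ≤ nbrCount n i A (suc x)
count-left n i A x e rewrite e = s≤s z≤n

count-right-off : ∀ n i A v → A (suc v) ≡ false → nbrCount n i A v ≤ 1
count-right-off n i A zero e rewrite e | ∧-zeroʳ (inV n i 1) = z≤n
count-right-off n i A (suc u) e rewrite e | ∧-zeroʳ (inV n i (suc (suc u))) | +-identityʳ (ind (inV n i u ∧ A u))
  = ind≤1 (inV n i u ∧ A u)

count-left-off : ∀ n i A v → LeftOff A v → nbrCount n i A v ≤ 1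
count-left-off n i A zero _ = ind≤1 _
count-left-off n i A (suc u) off rewrite off u refl | ∧-zeroʳ (inV n i u) = ind≤1 _

count-zero : ∀ n i A v → A (suc v) ≡ false → LeftOff A v → nbrCount n i A v ≡ 0
count-zero n i A zero e _ rewrite e | ∧-zeroʳ (inV n i 1) = refl
count-zero n i A (suc u) e off
  rewrite e | off u refl | ∧-zeroʳ (inV n i u) | ∧-zeroʳ (inV n i (suc (suc u))) = refl

count-cong : ∀ n i₁ i₂ A₁ A₂ v
  → (∀ u → suc u ≡ v → (inV n i₁ u ∧ A₁ u) ≡ (inV n i₂ u ∧ A₂ u))
  → (inV n i₁ (suc v) ∧ A₁ (suc v)) ≡ (inV n i₂ (suc v) ∧ A₂ (suc v))
  → nbrCount n i₁ A₁ v ≡ nbrCount n i₂ A₂ v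
count-cong n i₁ i₂ A₁ A₂ zero _ right = cong ind right
count-cong n i₁ i₂ A₁ A₂ (suc u) left right = cong₂ _+_ (cong ind (left u refl)) (cong ind right)

module Spread (t : ℕ → ℕ) (n w i : ℕ) (S : VSet) (w1 : 1 ≤ w) (sub : SubsetV n i S) where
  open Run t n w i S

  push : ∀ r x → Act (suc r) x ≡ true → inV n i (suc x) ≡ true → t (suc x) ≡ 1
       → Inf (suc r) (suc x) ≡ true
  push r x a ex tx = infect r (suc x) ex (subst (_≤ nbrCount n i (Act (suc r)) (suc x)) (sym tx)
    (count-left n i (Act (suc r)) x (∧-intro (inf⊆V sub r x (act⇒inf r x a)) a)))

  wave : ∀ r x → Inf r x ≡ true → inV n i (suc x) ≡ true → t (suc x) ≡ 1
       → Inf (suc r) (suc x) ≡ true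
  wave zero x e ex tx = push 0 x (seed-active w1 x e) ex tx
  wave (suc r) x e ex tx with true-or-false (Inf r x)
  ... | inj₁ old = inf-step {suc r} {suc x} (wave r x old ex tx)
  ... | inj₂ new = push (suc r) x (fresh-active w1 r x e new) ex tx

  sweep : ∀ a b → S a ≡ true → b ≤ n → (∀ x → a < x → x < b → t x ≡ 1)
        → ∀ R x → n ≤ R → a ≤ x → x < b → Inf R x ≡ true
  sweep a b sa bn ones R x nR ax xb =
    inf-mono {x ∸ a} {R} {x} (≤-trans (m∸n≤m x a) (≤-trans (<⇒≤ (<-≤-trans xb bn)) nR)) (front (≤⇒≤′ ax) xb)
    where
    front : ∀ {x} → a ≤′ x → x < b → Inf (x ∸ a) x ≡ true
    front ≤′-refl _ rewrite n∸n≡0 a = sa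
    front {suc y} (≤′-step ay) yb rewrite +-∸-assoc 1 (≤′⇒≤ ay) =
      wave (y ∸ a) y (front ay (<⇒≤ yb))
        (inV-intro {n} {i} (≤-trans (proj₁ (inV-elim {n} {i} (sub a sa))) (m≤n⇒m≤1+n (≤′⇒≤ ay))) (<-≤-trans yb bn))
        (ones (suc y) (s≤s (≤′⇒≤ ay)) yb)

module Locality (t : ℕ → ℕ) (n w i₁ i₂ : ℕ) (S₁ S₂ : VSet) (e : ℕ)
  (i₁≤e : i₁ ≤ e) (i₂≤e : i₂ ≤ e) (e₁ : S₁ e ≡ true) (e₂ : S₂ e ≡ true)
  (agree : ∀ x → e < x → S₁ x ≡ S₂ x) where
  module R₁ = Run t n w i₁ S₁
  module R₂ = Run t n w i₂ S₂

  Agree : ℕ → Set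
  Agree r = ∀ x → e ≤ x → R₁.Inf r x ≡ R₂.Inf r x

  -- Act at round r + 1 only depends on Inf at rounds r and r ∸ w.
  act-agree : ∀ r → (∀ {r'} → r' < suc r → Agree r') → ∀ u → e ≤ u
            → (inV n i₁ u ∧ R₁.Act (suc r) u) ≡ (inV n i₂ u ∧ R₂.Act (suc r) u)
  act-agree r ih u eu rewrite inV-agree n {i₁} {i₂} (≤-trans i₁≤e eu) (≤-trans i₂≤e eu) with w ≤? r
  ... | yes p rewrite R₁.act-late r u p | R₂.act-late r u p
                    | ih (s≤s ≤-refl) u eu | ih (s≤s (m∸n≤m r w)) u eu = refl
  ... | no p rewrite R₁.act-early r u (≰⇒> p) | R₂.act-early r u (≰⇒> p)
                   | ih (s≤s ≤-refl) u eu = refl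

  step : ∀ r → (∀ {r'} → r' < r → Agree r') → Agree r
  step zero _ x ex with m≤n⇒m<n∨m≡n ex
  ... | inj₁ e<x = agree x e<x
  ... | inj₂ refl = trans e₁ (sym e₂)
  step (suc r) ih x ex with m≤n⇒m<n∨m≡n ex
  ... | inj₂ refl = trans (R₁.inf-mono {0} {suc r} {e} z≤n e₁) (sym (R₂.inf-mono {0} {suc r} {e} z≤n e₂))
  ... | inj₁ e<x = cong₂ _∨_ (ih (s≤s ≤-refl) x ex)
        (cong₂ _∧_ (inV-agree n (≤-trans i₁≤e ex) (≤-trans i₂≤e ex))
          (cong (t x ≤ᵇ_) (count-cong n i₁ i₂ _ _ x
            (λ u su≡x → act-agree r ih u (≤-pred (subst (e <_) (sym su≡x) e<x)))
            (act-agree r ih (suc x) (m≤n⇒m≤1+n ex)))))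

  locality : ∀ r x → e ≤ x → R₁.Inf r x ≡ R₂.Inf r x
  locality = <-rec Agree step

module Barrier (t : ℕ → ℕ) (n w i : ℕ) (S : VSet) (w1 : 1 ≤ w) (sub : SubsetV n i S)
  (ts : Thresholds t n) (d e : ℕ) (td : t d ≡ 2) (se : S e ≡ true)
  (gap : ∀ x → d ≤ x → x < e → S x ≡ false) where
  open Run t n w i S

  FromRight : ℕ → Set
  FromRight r = ∀ x → d ≤ x → x < e → Inf r x ≡ true → Inf r (suc x) ≡ true

  two≰one : ∀ {m} → m ≡ 2 → ¬ (m ≤ 1)
  two≰one refl (s≤s ())

  left-quiet : ∀ r → FromRight r → ∀ x → d < x → x < e → Inf r x ≡ false → LeftOff (Act (suc r)) x
  left-quiet r fr (suc u) du ue f .u refl with true-or-false (Act (suc r) u)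
  ... | inj₂ off = off
  ... | inj₁ on = ⊥-elim (true≢false
          (trans (sym (fr u (≤-pred du) (<-trans (n<1+n u) ue) (act⇒inf r u on))) f))

  from-right : ∀ r → FromRight r
  from-right zero x dx xe s = ⊥-elim (true≢false (trans (sym s) (gap x dx xe)))
  from-right (suc r) x dx xe s with true-or-false (Inf r x)
  ... | inj₁ old = inf-step {r} {suc x} (from-right r x dx xe old)
  ... | inj₂ new with m≤n⇒m<n∨m≡n xe
  ...   | inj₂ refl = inf-mono {0} {suc r} {e} z≤n se
  ...   | inj₁ sx<e with true-or-false (Act (suc r) (suc x))
  ...     | inj₁ on = inf-step {r} {suc x} (act⇒inf r (suc x) on)
  ...     | inj₂ off with newly-infected r x s new | m≤n⇒m<n∨m≡n dx
  ...       | _ , enough | inj₂ refl =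
                ⊥-elim (two≰one td (≤-trans enough (count-right-off n i (Act (suc r)) d off)))
  ...       | inV-x , enough | inj₁ d<x =
                ⊥-elim (<-irrefl refl (≤-trans (threshold-pos ts x (proj₂ (inV-elim {n} {i} inV-x)))
                  (≤-trans enough (≤-reflexive (count-zero n i (Act (suc r)) x off
                    (left-quiet r (from-right r) x d<x (<-trans (n<1+n x) sx<e) new))))))

  gap-threshold : ∀ r x → d < x → x < e → Inf r x ≡ true → t x ≡ 1
  gap-threshold zero x dx xe s = ⊥-elim (true≢false (trans (sym s) (gap x (<⇒≤ dx) xe)))
  gap-threshold (suc r) x dx xe s with true-or-false (Inf r x)
  ... | inj₁ old = gap-threshold r x dx xe old
  ... | inj₂ new with newly-infected r x s new
  ...   | inV-x , enough with ts x (proj₂ (inV-elim {n} {i} inV-x))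
  ...     | inj₁ one = one
  ...     | inj₂ two = ⊥-elim (two≰one two (≤-trans enough
                (count-left-off n i (Act (suc r)) x (left-quiet r (from-right r) x dx xe new))))

Covered : (ℕ → ℕ) → ℕ → ℕ → ℕ → VSet → ℕ → Set
Covered t n i w S r = ∀ v → inV n i v ≡ true → Process.Inf t n i w S r v ≡ true

covered⇒target : ∀ t n i w S → SubsetV n i S → ∀ r → Covered t n i w S r → IsTWCTarget t n i w S
covered⇒target t n i w S sub r cov = r , on-V
  where
  open Run t n w i S
  on-V : ∀ v → Inf r v ≡ inV n i v
  on-V v with true-or-false (inV n i v) | true-or-false (Inf r v)
  ... | inj₁ inside | _ = trans (cov v inside) (sym inside)
  ... | inj₂ outside | inj₁ infected = ⊥-elim (true≢false (trans (sym (inf⊆V sub r v infected)) outside))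
  ... | inj₂ outside | inj₂ healthy = trans healthy (sym outside)

target⇒covered : ∀ t n i w S → (target : IsTWCTarget t n i w S)
               → ∀ r → proj₁ target ≤ r → Covered t n i w S r
target⇒covered t n i w S (r₀ , all) r le v inside =
  Run.inf-mono t n w i S {r₀} {r} {v} le (trans (all v) inside)

splice : ∀ t n w → 1 ≤ w → ∀ i j e S S' → IsTWCTarget t n i w S → SubsetV n j S'
       → i ≤ e → j ≤ e → e < n → S e ≡ true → S' e ≡ true → (∀ x → e < x → S' x ≡ S x)
       → S' j ≡ true → (∀ x → j < x → x < e → t x ≡ 1)
       → IsTWCTarget t n j w S'
splice t n w w1 i j e S S' target sub' ie je en se se' agree sj ones =
  covered⇒target t n j w S' sub' R covered
  where
  R : ℕ
  R = proj₁ target + n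
  covered : Covered t n j w S' R
  covered v inside with inV-elim {n} {j} inside | v <? e
  ... | jv , _ | yes v<e =
    Spread.sweep t n w j S' w1 sub' j e sj (<⇒≤ en) ones R v (m≤n+m n _) jv v<e
  ... | _ , vn | no v≮e =
    trans (Locality.locality t n w j i S' S e je ie se' se agree R v (≮⇒≥ v≮e))
          (target⇒covered t n i w S target R (m≤m+n _ n) v (inV-intro {n} {i} (≤-trans ie (≮⇒≥ v≮e)) vn))

-- If nothing changes during w rounds,
-- nothing is active any more and the process is stationary; otherwise a new
-- node is infected.  Hence the process is stationary by round (n + 1) · w.
module Decide (t : ℕ → ℕ) (n w i : ℕ) (S : VSet) (w1 : 1 ≤ w) (sub : SubsetV n i S)
  (ts : Thresholds t n) where
  open Run t n w i S

  inf-beyond : ∀ r v → n ≤ v → Inf r v ≡ false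
  inf-beyond r v nv with true-or-false (Inf r v)
  ... | inj₂ healthy = healthy
  ... | inj₁ infected = ⊥-elim (true≢false (trans (sym (inf⊆V sub r v infected)) (inV-beyond {n} {i} nv)))

  -- Since infection is monotone, rounds with equally many infected nodes agree.
  same-size⇒same : ∀ r r' → r ≤ r' → size n (Inf r) ≡ size n (Inf r') → ∀ v → Inf r v ≡ Inf r' v
  same-size⇒same r r' le eq v with v <? n
  ... | yes vn = size-≡⇒≡ n (Inf r) (Inf r') (λ u _ → inf-mono le) eq v vn
  ... | no v≮n = trans (inf-beyond r v (≮⇒≥ v≮n)) (sym (inf-beyond r' v (≮⇒≥ v≮n)))

  -- Without active nodes nothing new gets infected (all thresholds are ≥ 1).
  quiet : ∀ R → (∀ u → Act (suc R) u ≡ false) → ∀ v → Inf (suc R) v ≡ Inf R v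
  quiet R silent v with true-or-false (Inf R v) | true-or-false (Inf (suc R) v)
  ... | inj₁ old | _ = trans (inf-step {R} {v} old) (sym old)
  ... | inj₂ old | inj₂ now = trans now (sym old)
  ... | inj₂ old | inj₁ now with newly-infected R v now old
  ...   | inside , enough = ⊥-elim (<-irrefl refl (≤-trans (threshold-pos ts v (proj₂ (inV-elim {n} {i} inside)))
            (≤-trans enough (≤-reflexive (count-zero n i (Act (suc R)) v (silent (suc v)) (λ u _ → silent u))))))

  Stable : ℕ → Set
  Stable s = ∀ v → Inf s v ≡ Inf (s + w) v

  stuck : ∀ s → Stable s → ∀ j v → Inf (s + j) v ≡ Inf s v
  stuck s st = <-rec (λ j → ∀ v → Inf (s + j) v ≡ Inf s v) step
    where
    -- within the first w rounds Inf is squeezed between Inf s and Inf (s + w)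
    squeeze : ∀ j → j ≤ w → ∀ v → Inf (s + j) v ≡ Inf s v
    squeeze j j≤w v with true-or-false (Inf s v)
    ... | inj₁ old = trans (inf-mono (m≤m+n s j) old) (sym old)
    ... | inj₂ never = trans (not-yet (+-monoʳ-≤ s j≤w) (trans (sym (st v)) never)) (sym never)
    step : ∀ j → (∀ {j'} → j' < j → ∀ v → Inf (s + j') v ≡ Inf s v) → ∀ v → Inf (s + j) v ≡ Inf s v
    step zero _ = squeeze zero z≤n
    step (suc j) ih v with w ≤? j
    ... | no j≱w = squeeze (suc j) (≰⇒> j≱w) v
    ... | yes w≤j rewrite +-suc s j = trans (quiet (s + j) silent v) (ih ≤-refl v)
      where
      silent : ∀ u → Act (suc (s + j)) u ≡ false
      silent u rewrite act-late (s + j) u (≤-trans w≤j (m≤n+m j s)) | +-∸-assoc s w≤j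
                     | ih ≤-refl u | ih (s≤s (m∸n≤m j w)) u = ∧-inverseʳ (Inf s u)

  progress : ∀ j → (Σ ℕ λ s → s + w ≤ j * w × Stable s) ⊎ j ≤ size n (Inf (j * w))
  progress zero = inj₂ z≤n
  progress (suc j) with progress j
  ... | inj₁ (s , le , st) = inj₁ (s , ≤-trans le (m≤n+m (j * w) w) , st)
  ... | inj₂ grown with size n (Inf (j * w)) ≟ size n (Inf (j * w + w))
  ...   | yes same = inj₁ (j * w , ≤-reflexive (+-comm (j * w) w) ,
                           same-size⇒same (j * w) (j * w + w) (m≤m+n _ w) same)
  ...   | no differ = inj₂ (begin
            suc j                          ≤⟨ s≤s grown ⟩
            suc (size n (Inf (j * w)))     ≤⟨ ≤∧≢⇒< (size-mono n _ _ (λ u _ → inf-mono {j * w} {j * w + w} {u} (m≤m+n _ w))) differ ⟩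
            size n (Inf (j * w + w))       ≡⟨ cong (λ r → size n (Inf r)) (+-comm (j * w) w) ⟩
            size n (Inf (w + j * w))       ∎)
    where open ≤-Reasoning

  horizon : ℕ
  horizon = suc n * w

  stabilises : Σ ℕ λ s → s + w ≤ horizon × Stable s
  stabilises with progress (suc n)
  ... | inj₁ found = found
  ... | inj₂ too-many = ⊥-elim (1+n≰n (≤-trans too-many (size-bound n _)))

  covered-by-horizon : IsTWCTarget t n i w S → Covered t n i w S horizon
  covered-by-horizon target v inside with stabilises
  ... | s , le , st = inf-mono (≤-trans (m≤m+n s w) le)
        (trans (sym (stuck s st (proj₁ target) v))
               (target⇒covered t n i w S target (s + proj₁ target) (m≤n+m _ s) v inside))

  target? : Dec (IsTWCTarget t n i w S)
  target? with size n (Inf horizon) ≟ size n (inV n i)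
  ... | yes same = yes (covered⇒target t n i w S sub horizon covered)
    where
    covered : Covered t n i w S horizon
    covered v inside = trans (size-≡⇒≡ n (Inf horizon) (inV n i) (λ u _ → inf⊆V sub horizon u) same v
                                 (proj₂ (inV-elim {n} {i} inside))) inside
  ... | no differ = no λ target → differ (≤-antisym
          (size-mono n _ _ (λ u _ → inf⊆V sub horizon u))
          (size-mono n _ _ (λ u _ → covered-by-horizon target u)))

-- The search branches on the membership
-- of i, i + 1, … in turn.
module MinimumSearch (n i : ℕ) (P : VSet → Set)
  (P-sub : ∀ A → P A → SubsetV n i A)
  (P-resp : ∀ A B → (∀ v → A v ≡ B v) → P A → P B)
  (P? : ∀ A → SubsetV n i A → Dec (P A)) where

  Between : ℕ → VSet → VSet → Set
  Between f U B = (∀ v → U v ≡ true → B v ≡ true)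
                × (∀ v → B v ≡ true → (i ≤ v × v < i + f) ⊎ U v ≡ true)

  Result : ℕ → VSet → Set
  Result f U = (∀ B → Between f U B → ¬ P B)
             ⊎ Σ VSet (λ A → P A × (∀ B → Between f U B → P B → size n A ≤ size n B))

  below-next : ∀ {v} f → v < i + suc f → v < i + f ⊎ v ≡ i + f
  below-next {v} f lt = m≤n⇒m<n∨m≡n (≤-pred (subst (v <_) (+-suc i f) lt))

  split : ∀ f U B → Between (suc f) U B → Between f U B ⊎ Between f (insert (i + f) U) B
  split f U B (U⊆B , B⊆) with true-or-false (B (i + f))
  ... | inj₁ member = inj₂ (up , down)
    where
    up : ∀ v → insert (i + f) U v ≡ true → B v ≡ true
    up v e with insert-elim (i + f) U e
    ... | inj₁ refl = member
    ... | inj₂ u = U⊆B v u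
    down : ∀ v → B v ≡ true → (i ≤ v × v < i + f) ⊎ insert (i + f) U v ≡ true
    down v bv with B⊆ v bv
    ... | inj₂ u = inj₂ (insert-there (i + f) U u)
    ... | inj₁ (iv , lt) with below-next f lt
    ...   | inj₁ lt' = inj₁ (iv , lt')
    ...   | inj₂ refl = inj₂ (insert-here (i + f) U)
  ... | inj₂ non-member = inj₁ (U⊆B , down)
    where
    down : ∀ v → B v ≡ true → (i ≤ v × v < i + f) ⊎ U v ≡ true
    down v bv with B⊆ v bv
    ... | inj₂ u = inj₂ u
    ... | inj₁ (iv , lt) with below-next f lt
    ...   | inj₁ lt' = inj₁ (iv , lt')
    ...   | inj₂ refl = ⊥-elim (true≢false (trans (sym bv) non-member))

  search : ∀ f U → SubsetV n i U → i + f ≤ n → Result f U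
  search zero U sub _ with P? U sub
  ... | yes pu = inj₂ (U , pu , λ B (U⊆B , _) _ → size-mono n U B (λ u _ → U⊆B u))
  ... | no ¬pu = inj₁ λ B btw pb → ¬pu (P-resp B U (only-U B btw) pb)
    where
    only-U : ∀ B → Between zero U B → ∀ v → B v ≡ U v
    only-U B (U⊆B , B⊆) v with true-or-false (B v) | true-or-false (U v)
    ... | _ | inj₁ u = trans (U⊆B v u) (sym u)
    ... | inj₂ b | inj₂ u = trans b (sym u)
    ... | inj₁ b | inj₂ u with B⊆ v b
    ...   | inj₂ u' = ⊥-elim (true≢false (trans (sym u') u))
    ...   | inj₁ (iv , lt) = ⊥-elim (<⇒≱ (subst (v <_) (+-identityʳ i) lt) iv)
  search (suc f) U sub le = combine (search f U sub le') (search f U' sub' le')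
    where
    le' : i + f ≤ n
    le' = ≤-trans (+-monoʳ-≤ i (n≤1+n f)) le
    U' : VSet
    U' = insert (i + f) U
    sub' : SubsetV n i U'
    sub' v e with insert-elim (i + f) U e
    ... | inj₁ refl = inV-intro {n} {i} (m≤m+n i f) (<-≤-trans (≤-reflexive (sym (+-suc i f))) le)
    ... | inj₂ u = sub v u
    combine : Result f U → Result f U' → Result (suc f) U
    combine (inj₁ none₁) (inj₁ none₂) =
      inj₁ λ B btw pb → either (λ b → none₁ B b pb) (λ b → none₂ B b pb) (split f U B btw)
    combine (inj₂ (A , pa , min)) (inj₁ none) =
      inj₂ (A , pa , λ B btw pb → either (λ b → min B b pb) (λ b → ⊥-elim (none B b pb)) (split f U B btw))
    combine (inj₁ none) (inj₂ (A , pa , min)) =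
      inj₂ (A , pa , λ B btw pb → either (λ b → ⊥-elim (none B b pb)) (λ b → min B b pb) (split f U B btw))
    combine (inj₂ (A₁ , pa₁ , min₁)) (inj₂ (A₂ , pa₂ , min₂)) with size n A₁ ≤? size n A₂
    ... | yes le₁₂ = inj₂ (A₁ , pa₁ , λ B btw pb →
            either (λ b → min₁ B b pb) (λ b → ≤-trans le₁₂ (min₂ B b pb)) (split f U B btw))
    ... | no gt = inj₂ (A₂ , pa₂ , λ B btw pb →
            either (λ b → ≤-trans (<⇒≤ (≰⇒> gt)) (min₁ B b pb)) (λ b → min₂ B b pb) (split f U B btw))

  everything : i ≤ n → ∀ S → P S → Between (n ∸ i) (λ _ → false) S
  everything i≤n S ps = (λ v ()) , λ v e → let (iv , vn) = inV-elim {n} {i} (P-sub S ps v e)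
                                            in inj₁ (iv , subst (v <_) (sym (m+[n∸m]≡n i≤n)) vn)

  minimum : i ≤ n → ∀ A → P A
          → Σ ℕ λ m → (Σ VSet λ S → P S × size n S ≡ m) × (∀ S → P S → m ≤ size n S)
  minimum i≤n A pa with search (n ∸ i) (λ _ → false) (λ v ()) (≤-reflexive (m+[n∸m]≡n i≤n))
  ... | inj₂ (M , pm , min) = size n M , (M , pm , refl) , λ S ps → min S (everything i≤n S ps) ps
  ... | inj₁ none = ⊥-elim (none A (everything i≤n A pa) pa)

first-member : ∀ (A : VSet) a f → A (a + f) ≡ true
  → Σ ℕ λ e → a ≤ e × e ≤ a + f × A e ≡ true × (∀ x → a ≤ x → x < e → A x ≡ false)
first-member A a f last with true-or-false (A a)
... | inj₁ here = a , ≤-refl , m≤m+n a f , here , λ x ax xa → ⊥-elim (<⇒≱ xa ax)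
first-member A a zero last | inj₂ not-here =
  ⊥-elim (true≢false (trans (sym last) (trans (cong A (+-identityʳ a)) not-here)))
first-member A a (suc f) last | inj₂ not-here
  with first-member A (suc a) f (subst (λ y → A y ≡ true) (+-suc a f) last)
... | e , ae , ef , member , before =
  e , <⇒≤ ae , ≤-trans ef (≤-reflexive (sym (+-suc a f))) , member , earlier
  where
  earlier : ∀ x → a ≤ x → x < e → A x ≡ false
  earlier x ax xe with m≤n⇒m<n∨m≡n ax
  ... | inj₁ a<x = before x a<x xe
  ... | inj₂ refl = not-here

next-two-spec : ∀ t j f → let r = nextTwo t j f in
  j ≤ r × r ≤ j + f × (t r ≡ 2 ⊎ r ≡ j + f) × (∀ x → j ≤ x → x < r → t x ≢ 2)
next-two-spec t j zero = ≤-refl , m≤m+n j 0 , inj₂ (sym (+-identityʳ j)) , λ x jx xj → ⊥-elim (<⇒≱ xj jx)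
next-two-spec t j (suc f) with t j ≡ᵇ 2 in two?
... | true = ≤-refl , m≤m+n j (suc f) , inj₁ (≡ᵇ-sound two?) , λ x jx xj → ⊥-elim (<⇒≱ xj jx)
... | false with next-two-spec t (suc j) f
...   | jr , rf , found , before =
  <⇒≤ jr , ≤-trans rf (≤-reflexive (sym (+-suc j f))) , found' found , earlier
  where
  found' : _ ⊎ _ → _ ⊎ _
  found' (inj₁ two) = inj₁ two
  found' (inj₂ end) = inj₂ (trans end (sym (+-suc j f)))
  earlier : ∀ x → j ≤ x → x < nextTwo t (suc j) f → t x ≢ 2
  earlier x jx xr with m≤n⇒m<n∨m≡n jx
  ... | inj₁ j<x = before x j<x xr
  ... | inj₂ refl = λ two → true≢false (trans (sym (≡ᵇ-complete two)) two?)

D-spec : ∀ t n k → Thresholds t n → t (n ∸ 1) ≡ 2 → k < n → let d = D t n k in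
  k ≤ d × d < n × t d ≡ 2 × (∀ x → k < x → x < d → t x ≡ 1)
D-spec t n k ts tl k<n with k ≡ᵇ (n ∸ 1) in last?
... | true = ≤-last k<n , last<n k<n , tl , λ x kx xl → ⊥-elim (<⇒≱ (<-trans kx xl) (≤-reflexive (sym (≡ᵇ-sound last?))))
... | false with next-two-spec t (suc k) (n ∸ 1 ∸ suc k)
...   | kr , rl , found , before = <⇒≤ kr , r<n , two found , ones
  where
  k<l : k < n ∸ 1
  k<l = ≤∧≢⇒< (≤-last k<n) (λ eq → true≢false (trans (sym (≡ᵇ-complete eq)) last?))
  ends : suc k + (n ∸ 1 ∸ suc k) ≡ n ∸ 1
  ends = m+[n∸m]≡n k<l
  r<n : nextTwo t (suc k) (n ∸ 1 ∸ suc k) < n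
  r<n = ≤-last⇒< k<n (≤-trans rl (≤-reflexive ends))
  two : _ ⊎ _ → t (nextTwo t (suc k) (n ∸ 1 ∸ suc k)) ≡ 2
  two (inj₁ t2) = t2
  two (inj₂ end) = trans (cong t (trans end ends)) tl
  ones : ∀ x → k < x → x < nextTwo t (suc k) (n ∸ 1 ∸ suc k) → t x ≡ 1
  ones x kx xr with ts x (<-trans xr r<n)
  ... | inj₁ one = one
  ... | inj₂ t2 = ⊥-elim (before x kx xr t2)

module Admissibility (w : ℕ) (w1 : 1 ≤ w) (n : ℕ) (t : ℕ → ℕ) (ts : Thresholds t n) where

  admissible-resp : ∀ i A B → (∀ v → A v ≡ B v) → Admissible t n i w A → Admissible t n i w B
  admissible-resp i A B eq (sub , ai , al , target) =
    subB , bi , trans (sym (eq (n ∸ 1))) al , covered⇒target t n i w B subB (proj₁ target) covered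
    where
    subB : SubsetV n i B
    subB v bv = sub v (trans (eq v) bv)
    bi : B i ≡ true
    bi = trans (sym (eq i)) ai
    -- both runs contain i, so by locality they agree on all of L_i^n
    covered : Covered t n i w B (proj₁ target)
    covered v inside =
      trans (Locality.locality t n w i i B A i ≤-refl ≤-refl bi ai (λ x _ → sym (eq x))
               (proj₁ target) v (proj₁ (inV-elim {n} {i} inside)))
            (target⇒covered t n i w A target (proj₁ target) ≤-refl v inside)

  admissible? : ∀ i A → SubsetV n i A → Dec (Admissible t n i w A)
  admissible? i A sub with A i ≟ᵇ true | A (n ∸ 1) ≟ᵇ true | Decide.target? t n w i A w1 sub ts
  ... | yes ai | yes al | yes target = yes (sub , ai , al , target)
  ... | no ¬ai | _ | _ = no λ adm → ¬ai (proj₁ (proj₂ adm))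
  ... | yes _ | no ¬al | _ = no λ adm → ¬al (proj₁ (proj₂ (proj₂ adm)))
  ... | yes _ | yes _ | no ¬target = no λ adm → ¬target (proj₂ (proj₂ (proj₂ adm)))

  -- s(i) exists: the whole node set of L_i^n is admissible.
  s-exists : ∀ i → i < n → Σ ℕ (IsMinSize t n i w)
  s-exists i i<n = MinimumSearch.minimum n i (Admissible t n i w) (λ _ → proj₁)
    (admissible-resp i) (admissible? i) (<⇒≤ i<n) (inV n i) whole
    where
    whole : Admissible t n i w (inV n i)
    whole = (λ v e → e) , inV-intro {n} {i} ≤-refl i<n ,
            inV-intro {n} {i} (≤-last i<n) (last<n i<n) , 0 , λ v → refl

  extend : ∀ i d → i < d → d < n → (∀ x → i < x → x < d → t x ≡ 1)
         → ∀ S → Admissible t n d w S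
         → Σ VSet λ S' → Admissible t n i w S' × size n S' ≤ suc (size n S)
  extend i d i<d d<n ones S (sub , sd , sl , target) =
    S' , (sub' , insert-here i S , insert-there i S sl , target') , size-insert n i S S' (λ _ _ e → e)
    where
    S' : VSet
    S' = insert i S
    sub' : SubsetV n i S'
    sub' v e with insert-elim i S {v} e
    ... | inj₁ refl = inV-intro {n} {i} ≤-refl (<-trans i<d d<n)
    ... | inj₂ sv = let (dv , vn) = inV-elim {n} {d} (sub v sv) in inV-intro {n} {i} (≤-trans (<⇒≤ i<d) dv) vn
    above-d : ∀ x → d < x → S' x ≡ S x
    above-d x dx = insert-other i S (λ x≡i → <-irrefl (sym x≡i) (<-trans i<d dx))
    target' : IsTWCTarget t n i w S'
    target' = splice t n w w1 d i d S S' target sub' ≤-refl (<⇒≤ i<d) d<n sd (insert-there i S sd)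
                above-d (insert-here i S) ones

  restrict : ∀ i d → i ≤ d → d < n → t d ≡ 2 → ∀ S → Admissible t n i w S
           → Σ VSet λ S' → Admissible t n d w S' × size n S' ≤ size n S
  restrict i d i≤d d<n td S (sub , si , sl , target)
    with first-member S d (n ∸ 1 ∸ d) (subst (λ y → S y ≡ true) (sym (m+[n∸m]≡n (≤-last d<n))) sl)
  ... | e , d≤e , e≤l , se , gap = S' , (sub' , insert-here d A , last' , target') , smaller
    where
    A : VSet
    A = above d S
    S' : VSet
    S' = insert d A
    e<n : e < n
    e<n = ≤-last⇒< d<n (≤-trans e≤l (≤-reflexive (m+[n∸m]≡n (≤-last d<n))))
    sub' : SubsetV n d S'
    sub' v e' with insert-elim d A {v} e'
    ... | inj₁ refl = inV-intro {n} {d} ≤-refl d<n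
    ... | inj₂ av = let (dv , sv) = above-elim d S av
                    in inV-intro {n} {d} (<⇒≤ dv) (proj₂ (inV-elim {n} {i} (sub v sv)))
    agree : ∀ x → d < x → S' x ≡ S x
    agree x dx = trans (insert-other d A (λ x≡d → <-irrefl (sym x≡d) dx)) (above-agree d S dx)
    last' : S' (n ∸ 1) ≡ true
    last' with (n ∸ 1) ≟ d
    ... | yes l≡d = subst (λ y → S' y ≡ true) (sym l≡d) (insert-here d A)
    ... | no l≢d = trans (agree (n ∸ 1) (≤∧≢⇒< (≤-last d<n) (λ d≡l → l≢d (sym d≡l)))) sl
    se' : S' e ≡ true
    se' with m≤n⇒m<n∨m≡n d≤e
    ... | inj₁ d<e = trans (agree e d<e) se
    ... | inj₂ refl = insert-here d A
    -- the nodes of (d, e) get infected in the run of S, so the barrier applies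
    ones : ∀ x → d < x → x < e → t x ≡ 1
    ones x dx xe = Barrier.gap-threshold t n w i S w1 sub ts d e td se gap (proj₁ target) x dx xe
      (target⇒covered t n i w S target (proj₁ target) ≤-refl x
         (inV-intro {n} {i} (≤-trans i≤d (<⇒≤ dx)) (<-trans xe e<n)))
    target' : IsTWCTarget t n d w S'
    target' = splice t n w w1 i d e S S' target sub' (≤-trans i≤d d≤e) d≤e e<n se se' (λ x ex → agree x (≤-<-trans d≤e ex))
                (insert-here d A) ones
    smaller : size n S' ≤ size n S
    smaller = ≤-trans (size-insert n d A S' (λ _ _ e' → e'))
                (size-strict n A S i (λ u _ au → proj₂ (above-elim d S au))
                   (proj₂ (inV-elim {n} {i} (sub i si))) (above-below d S i≤d) si)

  s-lower : ∀ i d → i ≤ d → d < n → t d ≡ 2 → ∀ sd m → IsMinSize t n d w sd → IsMinSize t n i w m → sd ≤ m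
  s-lower i d i≤d d<n td sd m (_ , min-d) ((S , adm , refl) , _) with restrict i d i≤d d<n td S adm
  ... | S' , adm' , smaller = ≤-trans (min-d S' adm') smaller

  s-upper : ∀ i d → i ≤ d → d < n → (∀ x → i < x → x < d → t x ≡ 1)
          → ∀ sd m → IsMinSize t n d w sd → IsMinSize t n i w m → m ≤ suc sd
  s-upper i d i≤d d<n ones sd m ((S , adm , refl) , _) (_ , min-i) with m≤n⇒m<n∨m≡n i≤d
  ... | inj₂ refl = ≤-trans (min-i S adm) (n≤1+n _)
  ... | inj₁ i<d with extend i d i<d d<n ones S adm
  ...   | S' , adm' , larger = ≤-trans (min-i S' adm') larger

one-of-two : ∀ {s m} → s ≤ m → m ≤ suc s → m ≡ suc s ⊎ suc m ≡ suc s
one-of-two {s} {m} lower upper with m≤n⇒m<n∨m≡n upper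
... | inj₂ m≡1+s = inj₁ m≡1+s
... | inj₁ (s≤s m≤s) = inj₂ (cong suc (≤-antisym m≤s lower))

-- Lemma 3, with s_k = s(D[k]) + 1.
lemma3 : (w : ℕ) → 1 ≤ w → (n : ℕ) → (t : ℕ → ℕ)
    → (∀ v → v < n → t v ≡ 1 ⊎ t v ≡ 2) → t 0 ≡ 2 → t (n ∸ 1) ≡ 2
    → (k : ℕ) → k < n → t k ≡ 2
    → ∃ (λ sk → ∀ i → k ≤ i → i ≤ D t n k
         → ∀ m → IsMinSize t n i w m → m ≡ sk ⊎ suc m ≡ sk)
lemma3 w w1 n t ts _ tl k k<n _ with D-spec t n k ts tl k<n
... | k≤d , d<n , td , ones with Admissibility.s-exists w w1 n t ts (D t n k) d<n
...   | sd , min-d = suc sd , λ i k≤i i≤d m min-i → one-of-two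
          (Admissibility.s-lower w w1 n t ts i (D t n k) i≤d d<n td sd m min-d min-i)
          (Admissibility.s-upper w w1 n t ts i (D t n k) i≤d d<n
             (λ x ix xd → ones x (≤-<-trans k≤i ix) xd) sd m min-d min-i)
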